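{- Let $G$ be a graph, let $k$ be a positive integer, and let $D$ be a $k$-optimal set in $G$. For any independent set $S \subseteq V(G)$ disjoint from $D$, there are $k$ pairwise edge-disjoint matchings of $S$ into $D$ (i.e., consisting of edges with one endpoint in $S$ and the other in $D$), each saturating every vertex of $S$.
   Context: Graphs are finite and simple. A vertex set $D \subseteq V(G)$ is $k$-dependent if the induced subgraph $G[D]$ has maximum degree at most $k-1$. For a vertex set $D$, $\phi_k(D) = k|D| - |E(G[D])|$. A $k$-optimal set is a $k$-dependent set maximizing $\phi_k$ over all $k$-dependent sets of $G$. -}

module Defs where

open import Data.Bool using (Bool; true; false; _∧_; if_then_else_)
open import Data.Nat using (ℕ; zero; suc; _+_; _*_; _∸_; _≤_; _<ᵇ_)
open import Data.Integer using (ℤ; +_; _-_)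
open import Data.Fin using (Fin; toℕ)
open import Data.Fin.Subset using (Subset; _∈_; ∣_∣)
open import Data.Vec using (lookup)
open import Data.List using (List; map; allFin)
open import Data.Nat.ListAction using (sum)
open import Data.Product using (_×_)
open import Data.Sum using (_⊎_)
open import Relation.Binary.PropositionalEquality using (_≡_)
open import Relation.Nullary using (¬_)

record Graph (n : ℕ) : Set where
  field
    adj     : Fin n → Fin n → Bool
    sym     : ∀ u v → adj u v ≡ adj v u
    irrefl  : ∀ v → adj v v ≡ false
open Graph public

Σ-Fin : ∀ {n} → (Fin n → ℕ) → ℕ
Σ-Fin {n} f = sum (map f (allFin n))

indicator : Bool → ℕ
indicator b = if b then 1 else 0

module _ {n : ℕ} (G : Graph n) where

  degIn : Subset n → Fin n → ℕ
  degIn D v = Σ-Fin (λ u → indicator (lookup D u ∧ adj G v u))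

  edgesIn : Subset n → ℕ
  edgesIn D = Σ-Fin (λ i → Σ-Fin (λ j →
      indicator ((toℕ i <ᵇ toℕ j) ∧ (lookup D i ∧ (lookup D j ∧ adj G i j)))))

  IsKDependent : ℕ → Subset n → Set
  IsKDependent k D = ∀ v → v ∈ D → degIn D v ≤ k ∸ 1

  φ : ℕ → Subset n → ℤ
  φ k D = + (k * ∣ D ∣) - + edgesIn D

  IsKOptimal : ℕ → Subset n → Set
  IsKOptimal k D = IsKDependent k D ×
    (∀ D′ → IsKDependent k D′ → φ k D′ Data.Integer.≤ φ k D)

  IsIndependent : Subset n → Set
  IsIndependent S = ∀ u v → u ∈ S → v ∈ S → adj G u v ≡ false

  Disjoint : Subset n → Subset n → Set
  Disjoint S D = ∀ v → v ∈ S → ¬ (v ∈ D)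

  -- A matching of S into D saturating every vertex of S, given as the map
  -- sending each s ∈ S to its partner: partners lie in D, are adjacent to s,
  -- and distinct vertices of S get distinct partners.
  IsSaturatingMatching : Subset n → Subset n → (Fin n → Fin n) → Set
  IsSaturatingMatching S D f =
    (∀ s → s ∈ S → f s ∈ D) ×
    (∀ s → s ∈ S → adj G s (f s) ≡ true) ×
    (∀ s t → s ∈ S → t ∈ S → f s ≡ f t → s ≡ t)

SameEdge : ∀ {n} → Fin n → Fin n → Fin n → Fin n → Set
SameEdge a b c d = (a ≡ c × b ≡ d) ⊎ (a ≡ d × b ≡ c)

-- Give every vertex of S a supply of k, every vertex of D a capacity of k and every S–D edge a
-- capacity of 1. By Gale's supply–demand theorem an integral flow meeting all supplies exists iff
-- every cut (A, B) satisfies k |A ∩ S| ≤ k |B ∩ D| + e(A ∩ S, D ∖ B). This inequality is where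
-- k-optimality enters: deleting vertices of degree ≥ k never decreases φ_k, so every set X has a
-- k-dependent D′ with φ_k X ≤ φ_k D′ ≤ φ_k D. For X = (D ∖ B) ∪ (A ∩ S), with S independent and
-- disjoint from D, this rearranges to the cut inequality.
--
-- The flow F is a bipartite multigraph in which S has degree k and D degree at most k. As its rows (S)
-- and columns (D) are disjoint, F + Fᵀ topped up on the diagonal is k-regular, so by König's theorem
-- it dominates k permutation matrices; on S these are k edge-disjoint matchings into D.
--
-- Gale's theorem itself is proved by induction on the total supply: move one unit from u along an
-- edge (u, v) that no tight cut separates. If every usable v were separated, the union of the
-- separating tight cuts (tight cuts are closed under union by submodularity) would violate the cut
-- condition once u is added to it.

module Submission where

open import Data.Bool using (Bool; true; false; _∧_; _∨_; not; if_then_else_)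
open import Data.Bool.Properties
  using (∧-zeroʳ; ∨-zeroʳ; ∧-identityʳ; ∨-identityʳ; ∧-conicalˡ; ∧-conicalʳ) renaming (_≟_ to _≟ᵇ_)
open import Data.Nat
  using (ℕ; NonZero; zero; suc; _+_; _*_; _∸_; _≤_; _<_; z≤n; s≤s; _≤?_; _<?_; _≡ᵇ_; _<ᵇ_)
open import Data.Nat.Properties hiding (_≟_)
open import Data.Nat.Tactic.RingSolver using (solve-∀)
import Data.Nat.ListAction as List
import Data.Integer as ℤ
import Data.Integer.Properties as ℤ
open import Data.Integer.Tactic.RingSolver renaming (solve-∀ to ℤ-solve-∀)
open import Data.Fin using (Fin; zero; suc; toℕ)
open import Data.Fin.Properties using (_≟_; any?; toℕ-injective)
open import Data.Fin.Subset using (Subset; _∈_; ∣_∣)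
open import Data.Fin.Subset.Properties using (anySubset?; _∈?_)
open import Data.Vec using ([]; _∷_; lookup) renaming (tabulate to tabulateᵛ)
open import Data.Vec.Properties using (lookup∘tabulate; []=⇒lookup; lookup⇒[]=)
open import Data.List using (List; []; _∷_; map; tabulate; allFin)
open import Data.List.Relation.Unary.All as All using (All; []; _∷_)
open import Data.List.Relation.Unary.All.Properties using (tabulate⁻)
open import Data.Product using (Σ; ∃; _×_; _,_; proj₁; proj₂)
open import Data.Sum using (inj₁; inj₂)
open import Data.Empty using (⊥-elim)
open import Function using (_∘_; id)
open import Relation.Nullary using (¬_; Dec; yes; no; does)
open import Relation.Nullary.Decidable using (_×-dec_; ¬?; decidable-stable)
open import Relation.Binary.PropositionalEquality
open import Algebra.Properties.Semiring.Sum +-*-semiring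
  using (sum; sum-syntax; ∑-distrib-+; ∑-comm; sum-cong-≗; sum-replicate-zero; *-distribˡ-sum; *-distribʳ-sum)
open import Algebra.Properties.CommutativeSemigroup +-commutativeSemigroup using (interchange)
open import Defs
  using (Σ-Fin; indicator; Graph; adj; irrefl; degIn; edgesIn; φ; IsKDependent; IsKOptimal;
         IsIndependent; Disjoint; IsSaturatingMatching; SameEdge)
  renaming (sym to adj-sym)


mask : Bool → ℕ → ℕ
mask b x = if b then x else 0

mask-0 : ∀ b → mask b 0 ≡ 0
mask-0 true = refl
mask-0 false = refl

mask-≤ : ∀ b x → mask b x ≤ x
mask-≤ true x = ≤-refl
mask-≤ false x = z≤n

mask-mono : ∀ b {x y} → x ≤ y → mask b x ≤ mask b y
mask-mono true x≤y = x≤y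
mask-mono false _ = z≤n

mask-+ : ∀ b x y → mask b (x + y) ≡ mask b x + mask b y
mask-+ true x y = refl
mask-+ false x y = refl

mask-* : ∀ b k x → mask b (k * x) ≡ k * mask b x
mask-* true k x = refl
mask-* false k x = sym (*-zeroʳ k)

mask-∧ : ∀ a b x → mask a (mask b x) ≡ mask (a ∧ b) x
mask-∧ true b x = refl
mask-∧ false b x = refl

mask-comm : ∀ a b x → mask a (mask b x) ≡ mask b (mask a x)
mask-comm true true x = refl
mask-comm true false x = refl
mask-comm false true x = refl
mask-comm false false x = refl

mask-∑ : ∀ {n} b (f : Fin n → ℕ) → mask b (sum f) ≡ sum (λ u → mask b (f u))
mask-∑ true f = refl
mask-∑ {n} false f = sym (sum-replicate-zero n)

mask-∨-∧ : ∀ a b x → mask (a ∨ b) x + mask (a ∧ b) x ≡ mask a x + mask b x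
mask-∨-∧ true b x = refl
mask-∨-∧ false b x = +-comm (mask b x) 0

mask-∁ : ∀ b x → mask b x + mask (not b) x ≡ x
mask-∁ true x = +-identityʳ x
mask-∁ false x = refl

mask-zero : ∀ b {x} → (b ≡ true → x ≡ 0) → mask b x ≡ 0
mask-zero true x≡0 = x≡0 refl
mask-zero false _ = refl

mask-submodular : ∀ a b {x∪ x∩ x y} → x∪ + x∩ ≡ x + y → x∪ ≤ x → x∪ ≤ y →
  mask (a ∨ b) x∪ + mask (a ∧ b) x∩ ≤ mask a x + mask b y
mask-submodular true true sum≡ _ _ = ≤-reflexive sum≡
mask-submodular true false _ x∪≤x _ = +-monoˡ-≤ 0 x∪≤x
mask-submodular false true _ _ x∪≤y = ≤-trans (≤-reflexive (+-identityʳ _)) x∪≤y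
mask-submodular false false _ _ _ = z≤n

indicator≤1 : ∀ b → indicator b ≤ 1
indicator≤1 true = ≤-refl
indicator≤1 false = z≤n

indicator-pos : ∀ b → 0 < indicator b → b ≡ true
indicator-pos true _ = refl

Σ-Fin≡sum : ∀ {n} (f : Fin n → ℕ) → Σ-Fin f ≡ sum f
Σ-Fin≡sum = go id
  where
  go : ∀ {A : Set} {n} (g : Fin n → A) (f : A → ℕ) → List.sum (map f (tabulate g)) ≡ sum (f ∘ g)
  go {n = zero} g f = refl
  go {n = suc n} g f = cong (f (g zero) +_) (go (g ∘ suc) f)

∑-zero : ∀ {n} {f : Fin n → ℕ} → (∀ i → f i ≡ 0) → sum f ≡ 0
∑-zero {n} f≗0 = trans (sum-cong-≗ f≗0) (sum-replicate-zero n)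

∑-mono-≤ : ∀ {n} {f g : Fin n → ℕ} → (∀ i → f i ≤ g i) → sum f ≤ sum g
∑-mono-≤ {zero} _ = z≤n
∑-mono-≤ {suc n} f≤g = +-mono-≤ (f≤g zero) (∑-mono-≤ (f≤g ∘ suc))

∑-∸ : ∀ {n} {f g : Fin n → ℕ} → (∀ i → g i ≤ f i) → sum (λ i → f i ∸ g i) + sum g ≡ sum f
∑-∸ {f = f} {g} g≤f =
  trans (sym (∑-distrib-+ (λ i → f i ∸ g i) g)) (sum-cong-≗ (λ i → m∸n+n≡m (g≤f i)))

∑-pos : ∀ {n} (f : Fin n → ℕ) → 0 < sum f → ∃ λ i → 0 < f i
∑-pos {suc n} f pos with f zero in eq
... | suc _ = zero , subst (0 <_) (sym eq) (s≤s z≤n)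
... | zero with ∑-pos (f ∘ suc) pos
...   | i , fi>0 = suc i , fi>0

term≤∑ : ∀ {n} (f : Fin n → ℕ) i → f i ≤ sum f
term≤∑ f zero = m≤m+n _ _
term≤∑ f (suc i) = ≤-trans (term≤∑ (f ∘ suc) i) (m≤n+m _ _)

two-terms≤∑ : ∀ {n} (f : Fin n → ℕ) {i j} → i ≢ j → f i + f j ≤ sum f
two-terms≤∑ f {zero} {zero} i≢j = ⊥-elim (i≢j refl)
two-terms≤∑ f {zero} {suc j} _ = +-monoʳ-≤ (f zero) (term≤∑ (f ∘ suc) j)
two-terms≤∑ f {suc i} {zero} _ =
  subst (_≤ sum f) (+-comm (f zero) (f (suc i))) (+-monoʳ-≤ (f zero) (term≤∑ (f ∘ suc) i))
two-terms≤∑ f {suc i} {suc j} i≢j =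
  ≤-trans (two-terms≤∑ (f ∘ suc) (i≢j ∘ cong suc)) (m≤n+m _ _)

∑≤1⇒unique-pos : ∀ {n} (f : Fin n → ℕ) → sum f ≤ 1 → ∀ {i j} → 0 < f i → 0 < f j → i ≡ j
∑≤1⇒unique-pos f ∑≤1 {i} {j} fi>0 fj>0 with i ≟ j
... | yes i≡j = i≡j
... | no i≢j = ⊥-elim (<⇒≱ (+-mono-≤ fi>0 fj>0) (≤-trans (two-terms≤∑ f i≢j) ∑≤1))

∑-tight : ∀ {n} {f g : Fin n → ℕ} → (∀ i → f i ≤ g i) → sum g ≤ sum f → ∀ i → f i ≡ g i
∑-tight f≤g g≤f zero = ≤-antisym (f≤g zero)
  (+-cancelʳ-≤ _ _ _ (≤-trans (+-monoʳ-≤ _ (∑-mono-≤ (f≤g ∘ suc))) g≤f))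
∑-tight f≤g g≤f (suc i) = ∑-tight (f≤g ∘ suc)
  (+-cancelˡ-≤ _ _ _ (≤-trans g≤f (+-monoˡ-≤ _ (f≤g zero)))) i


-- Vertex sets are Boolean predicates; Subset n is used only at the interface with the statement and
-- where all vertex sets have to be enumerated.
Pred : ℕ → Set
Pred n = Fin n → Bool

variable
  n : ℕ
  p p′ q q′ A A′ B B′ : Pred n
  f g : Fin n → ℕ

module _ {n : ℕ} where

  infixr 7 _∩_
  infixr 6 _∪_

  _∪_ _∩_ : Pred n → Pred n → Pred n
  (p ∪ q) u = p u ∨ q u
  (p ∩ q) u = p u ∧ q u

  ∁ : Pred n → Pred n
  ∁ p u = not (p u)

  ∅ : Pred n
  ∅ _ = false

  ⁅_⁆ : Fin n → Pred n
  ⁅ v ⁆ u = does (v ≟ u)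

  infix 4 _⊆_
  _⊆_ : Pred n → Pred n → Set
  p ⊆ q = ∀ u → p u ≡ true → q u ≡ true

⁅⁆-sym : ∀ (u v : Fin n) → ⁅ u ⁆ v ≡ ⁅ v ⁆ u
⁅⁆-sym u v with u ≟ v | v ≟ u
... | yes _ | yes _ = refl
... | no _ | no _ = refl
... | yes u≡v | no v≢u = ⊥-elim (v≢u (sym u≡v))
... | no u≢v | yes v≡u = ⊥-elim (u≢v (sym v≡u))

∁-∪ : ∀ (B B′ : Pred n) u → ∁ (B ∪ B′) u ≡ (∁ B ∩ ∁ B′) u
∁-∪ B B′ u with B u
... | true = refl
... | false = refl

∁-∩ : ∀ (B B′ : Pred n) u → ∁ (B ∩ B′) u ≡ (∁ B ∪ ∁ B′) u
∁-∩ B B′ u with B u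
... | true = refl
... | false = refl

∁∪⊆∁ˡ : ∀ (B B′ : Pred n) → ∁ (B ∪ B′) ⊆ ∁ B
∁∪⊆∁ˡ B B′ v with B v
... | false = λ _ → refl

∁∪⊆∁ʳ : ∀ (B B′ : Pred n) → ∁ (B ∪ B′) ⊆ ∁ B′
∁∪⊆∁ʳ B B′ v with B v
... | false = id
... | true = λ ()

∑∈ : Pred n → (Fin n → ℕ) → ℕ
∑∈ p f = sum (λ u → mask (p u) (f u))

syntax ∑∈ p (λ u → e) = ∑[ u ∈ p ] e

∑∈-cong : p ≗ q → f ≗ g → ∑∈ p f ≡ ∑∈ q g
∑∈-cong p≗q f≗g = sum-cong-≗ (λ u → cong₂ mask (p≗q u) (f≗g u))

∑∈-mono-≤ : (∀ u → f u ≤ g u) → ∑∈ p f ≤ ∑∈ p g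
∑∈-mono-≤ {p = p} f≤g = ∑-mono-≤ (λ u → mask-mono (p u) (f≤g u))

∑∈-mono-⊆ : p ⊆ q → ∀ f → ∑∈ p f ≤ ∑∈ q f
∑∈-mono-⊆ {p = p} {q = q} p⊆q f = ∑-mono-≤ pointwise
  where
  pointwise : ∀ u → mask (p u) (f u) ≤ mask (q u) (f u)
  pointwise u with p u in pu
  ... | false = z≤n
  ... | true rewrite p⊆q u pu = ≤-refl

∑∈≤∑ : ∀ (p : Pred n) f → ∑∈ p f ≤ sum f
∑∈≤∑ p f = ∑-mono-≤ (λ u → mask-≤ (p u) (f u))

∑∈-distrib-+ : ∀ (p : Pred n) f g → ∑[ u ∈ p ] (f u + g u) ≡ ∑∈ p f + ∑∈ p g
∑∈-distrib-+ p f g =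
  trans (sum-cong-≗ (λ u → mask-+ (p u) (f u) (g u)))
        (∑-distrib-+ (λ u → mask (p u) (f u)) (λ u → mask (p u) (g u)))

∑∈-*ˡ : ∀ (p : Pred n) k f → ∑[ u ∈ p ] (k * f u) ≡ k * ∑∈ p f
∑∈-*ˡ p k f =
  trans (sum-cong-≗ (λ u → mask-* (p u) k (f u))) (sym (*-distribˡ-sum k (λ u → mask (p u) (f u))))

∑∈-const : ∀ (p : Pred n) k → ∑[ u ∈ p ] k ≡ k * ∑[ u ∈ p ] 1
∑∈-const p k = trans (∑∈-cong {p = p} (λ _ → refl) (λ _ → sym (*-identityʳ k))) (∑∈-*ˡ p k (λ _ → 1))

∑∈-∩ : ∀ (p q : Pred n) f → ∑[ u ∈ p ] mask (q u) (f u) ≡ ∑∈ (p ∩ q) f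
∑∈-∩ p q f = sum-cong-≗ (λ u → mask-∧ (p u) (q u) (f u))

∑∈-∁ : ∀ (p : Pred n) f → ∑∈ p f + ∑∈ (∁ p) f ≡ sum f
∑∈-∁ p f = trans (sym (∑-distrib-+ (λ u → mask (p u) (f u)) (λ u → mask (not (p u)) (f u))))
                 (sum-cong-≗ (λ u → mask-∁ (p u) (f u)))

∑∈-partition : ∀ (p q : Pred n) f → ∑∈ (p ∩ q) f + ∑∈ (∁ p ∩ q) f ≡ ∑∈ q f
∑∈-partition p q f =
  trans (sym (cong₂ _+_ (∑∈-∩ p q f) (∑∈-∩ (∁ p) q f))) (∑∈-∁ p (λ u → mask (q u) (f u)))

∑∈-∪-∩ : ∀ (p q : Pred n) f → ∑∈ (p ∪ q) f + ∑∈ (p ∩ q) f ≡ ∑∈ p f + ∑∈ q f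
∑∈-∪-∩ p q f = begin
  ∑∈ (p ∪ q) f + ∑∈ (p ∩ q) f
    ≡⟨ ∑-distrib-+ (λ u → mask (p u ∨ q u) (f u)) (λ u → mask (p u ∧ q u) (f u)) ⟨
  ∑[ u < _ ] (mask (p u ∨ q u) (f u) + mask (p u ∧ q u) (f u))
    ≡⟨ sum-cong-≗ (λ u → mask-∨-∧ (p u) (q u) (f u)) ⟩
  ∑[ u < _ ] (mask (p u) (f u) + mask (q u) (f u))
    ≡⟨ ∑-distrib-+ (λ u → mask (p u) (f u)) (λ u → mask (q u) (f u)) ⟩
  ∑∈ p f + ∑∈ q f ∎
  where open ≡-Reasoning

∑∈-∪-≤ : ∀ (p q : Pred n) f → ∑∈ (p ∪ q) f ≤ ∑∈ p f + ∑∈ q f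
∑∈-∪-≤ p q f = ≤-trans (m≤m+n _ _) (≤-reflexive (∑∈-∪-∩ p q f))

∑∈-empty : ∀ (p : Pred n) f → p ≗ ∅ → ∑∈ p f ≡ 0
∑∈-empty {n} p f p≗∅ = trans (∑∈-cong p≗∅ (λ _ → refl)) (sum-replicate-zero n)

∑∈-∪ : ∀ (p q : Pred n) f → p ∩ q ≗ ∅ → ∑∈ (p ∪ q) f ≡ ∑∈ p f + ∑∈ q f
∑∈-∪ p q f disjoint = begin
  ∑∈ (p ∪ q) f                 ≡⟨ +-identityʳ _ ⟨
  ∑∈ (p ∪ q) f + 0             ≡⟨ cong (∑∈ (p ∪ q) f +_) (∑∈-empty (p ∩ q) f disjoint) ⟨
  ∑∈ (p ∪ q) f + ∑∈ (p ∩ q) f  ≡⟨ ∑∈-∪-∩ p q f ⟩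
  ∑∈ p f + ∑∈ q f              ∎
  where open ≡-Reasoning

∑∈-⁅⁆ : ∀ (v : Fin n) f → ∑∈ ⁅ v ⁆ f ≡ f v
∑∈-⁅⁆ {suc n} zero f = trans (cong (f zero +_) (sum-replicate-zero n)) (+-identityʳ _)
∑∈-⁅⁆ {suc n} (suc v) f = ∑∈-⁅⁆ v (f ∘ suc)

∣∣≡∑∈ : ∀ (X : Subset n) → ∣ X ∣ ≡ ∑[ u ∈ lookup X ] 1
∣∣≡∑∈ [] = refl
∣∣≡∑∈ (true ∷ X) = cong suc (∣∣≡∑∈ X)
∣∣≡∑∈ (false ∷ X) = ∣∣≡∑∈ X

δ : Fin n → Fin n → ℕ
δ u w = indicator (⁅ u ⁆ w)

∑∈-δ : ∀ (A : Pred n) u → ∑∈ A (δ u) ≡ indicator (A u)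
∑∈-δ A u = trans (sum-cong-≗ (λ w → mask-comm (A w) (⁅ u ⁆ w) 1)) (∑∈-⁅⁆ u (λ w → indicator (A w)))

δ-≤ : ∀ (u : Fin n) → 0 < f u → ∀ w → δ u w ≤ f w
δ-≤ u fu>0 w with u ≟ w
... | yes refl = fu>0
... | no _ = z≤n


Matrix : ℕ → Set
Matrix n = Fin n → Fin n → ℕ

variable
  r c r′ c′ : Fin n → ℕ
  C C′ X : Matrix n

colSum : Matrix n → Fin n → ℕ
colSum X v = ∑[ u < _ ] X u v

across : Pred n → Pred n → Matrix n → ℕ
across A B C = ∑[ u ∈ A ] ∑[ v ∈ B ] C u v

across-cong : A ≗ A′ → B ≗ B′ → across A B C ≡ across A′ B′ C
across-cong A≗A′ B≗B′ = ∑∈-cong A≗A′ (λ u → ∑∈-cong B≗B′ (λ _ → refl))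

across-distrib-+ : ∀ (A B : Pred n) C C′ →
  across A B (λ u v → C u v + C′ u v) ≡ across A B C + across A B C′
across-distrib-+ A B C C′ = trans (∑∈-cong (λ _ → refl) (λ u → ∑∈-distrib-+ B (C u) (C′ u)))
  (∑∈-distrib-+ A (λ u → ∑∈ B (C u)) (λ u → ∑∈ B (C′ u)))

across-⊗ : ∀ (A B : Pred n) f g → across A B (λ u v → f u * g v) ≡ ∑∈ A f * ∑∈ B g
across-⊗ A B f g = begin
  ∑[ u ∈ A ] ∑[ v ∈ B ] (f u * g v) ≡⟨ ∑∈-cong (λ _ → refl) (λ u → ∑∈-*ˡ B (f u) g) ⟩
  ∑[ u ∈ A ] (f u * ∑∈ B g)         ≡⟨ ∑∈-cong (λ _ → refl) (λ u → *-comm (f u) (∑∈ B g)) ⟩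
  ∑[ u ∈ A ] (∑∈ B g * f u)         ≡⟨ ∑∈-*ˡ A (∑∈ B g) f ⟩
  ∑∈ B g * ∑∈ A f                   ≡⟨ *-comm (∑∈ B g) (∑∈ A f) ⟩
  ∑∈ A f * ∑∈ B g                   ∎
  where open ≡-Reasoning

across-mask : ∀ (A B s d : Pred n) M →
  across A B (λ u v → mask (s u) (mask (d v) (M u v))) ≡ across (A ∩ s) (B ∩ d) M
across-mask A B s d M = begin
  ∑[ u ∈ A ] ∑[ v ∈ B ] mask (s u) (mask (d v) (M u v))
    ≡⟨ ∑∈-cong (λ _ → refl) pull-out ⟩
  ∑[ u ∈ A ] mask (s u) (∑[ v ∈ B ] mask (d v) (M u v))
    ≡⟨ ∑∈-∩ A s _ ⟩
  ∑[ u ∈ A ∩ s ] ∑[ v ∈ B ] mask (d v) (M u v)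
    ≡⟨ ∑∈-cong (λ _ → refl) (λ u → ∑∈-∩ B d (M u)) ⟩
  across (A ∩ s) (B ∩ d) M ∎
  where
  open ≡-Reasoning
  pull-out : ∀ u → ∑[ v ∈ B ] mask (s u) (mask (d v) (M u v)) ≡ mask (s u) (∑[ v ∈ B ] mask (d v) (M u v))
  pull-out u = trans (sum-cong-≗ (λ v → mask-comm (B v) (s u) _))
                     (sym (mask-∑ (s u) (λ v → mask (B v) (mask (d v) (M u v)))))

δ⊗δ-≤ : ∀ (u v : Fin n) → 0 < C u v → ∀ a b → δ u a * δ v b ≤ C a b
δ⊗δ-≤ u v Cuv>0 a b with u ≟ a | v ≟ b
... | yes refl | yes refl = Cuv>0
... | yes refl | no _ = z≤n
... | no _ | _ = z≤n

across-submodular : ∀ (A A′ B B′ : Pred n) C →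
  across (A ∪ A′) (∁ (B ∪ B′)) C + across (A ∩ A′) (∁ (B ∩ B′)) C
    ≤ across A (∁ B) C + across A′ (∁ B′) C
across-submodular A A′ B B′ C = begin
  across (A ∪ A′) (∁ (B ∪ B′)) C + across (A ∩ A′) (∁ (B ∩ B′)) C
    ≡⟨ ∑-distrib-+ (λ u → mask ((A ∪ A′) u) (out∪ u)) (λ u → mask ((A ∩ A′) u) (out∩ u)) ⟨
  ∑[ u < _ ] (mask ((A ∪ A′) u) (out∪ u) + mask ((A ∩ A′) u) (out∩ u))
    ≤⟨ ∑-mono-≤ (λ u → mask-submodular (A u) (A′ u) (out-modular u)
                       (out-mono (∁∪⊆∁ˡ B B′) u) (out-mono (∁∪⊆∁ʳ B B′) u)) ⟩
  ∑[ u < _ ] (mask (A u) (out B u) + mask (A′ u) (out B′ u))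
    ≡⟨ ∑-distrib-+ (λ u → mask (A u) (out B u)) (λ u → mask (A′ u) (out B′ u)) ⟩
  across A (∁ B) C + across A′ (∁ B′) C ∎
  where
  open ≤-Reasoning
  out : Pred _ → Fin _ → ℕ
  out B u = ∑[ v ∈ ∁ B ] C u v
  out∪ out∩ : Fin _ → ℕ
  out∪ = out (B ∪ B′)
  out∩ = out (B ∩ B′)
  out-modular : ∀ u → out∪ u + out∩ u ≡ out B u + out B′ u
  out-modular u = begin-equality
    out∪ u + out∩ u
      ≡⟨ cong₂ _+_ (∑∈-cong (∁-∪ B B′) (λ _ → refl)) (∑∈-cong (∁-∩ B B′) (λ _ → refl)) ⟩
    ∑∈ (∁ B ∩ ∁ B′) (C u) + ∑∈ (∁ B ∪ ∁ B′) (C u)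
      ≡⟨ +-comm (∑∈ (∁ B ∩ ∁ B′) (C u)) _ ⟩
    ∑∈ (∁ B ∪ ∁ B′) (C u) + ∑∈ (∁ B ∩ ∁ B′) (C u)
      ≡⟨ ∑∈-∪-∩ (∁ B) (∁ B′) (C u) ⟩
    out B u + out B′ u ∎
  out-mono : ∀ {B₀} → ∁ (B ∪ B′) ⊆ ∁ B₀ → ∀ u → out∪ u ≤ out B₀ u
  out-mono ⊆∁B₀ u = ∑∈-mono-⊆ ⊆∁B₀ (C u)


-- Gale's supply–demand theorem

-- A transport problem on Fin n: row u supplies r u, column v absorbs at most c v, and at most C u v
-- may go from u to v.
CutCondition : (r c : Fin n → ℕ) → Matrix n → Set
CutCondition {n} r c C = ∀ (A B : Pred n) → ∑∈ A r ≤ ∑∈ B c + across A (∁ B) C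

Tight : (r c : Fin n → ℕ) → Matrix n → Pred n → Pred n → Set
Tight r c C A B = ∑∈ B c + across A (∁ B) C ≤ ∑∈ A r

record IsFlow (r c : Fin n → ℕ) (C X : Matrix n) : Set where
  field
    within-capacity : ∀ u v → X u v ≤ C u v
    meets-supply    : ∀ u → sum (X u) ≡ r u
    within-demand   : ∀ v → colSum X v ≤ c v

open IsFlow

Tight-cong : A ≗ A′ → B ≗ B′ → Tight r c C A B → Tight r c C A′ B′
Tight-cong A≗A′ B≗B′ = subst₂ _≤_
  (cong₂ _+_ (∑∈-cong B≗B′ (λ _ → refl)) (across-cong A≗A′ (cong not ∘ B≗B′)))
  (∑∈-cong A≗A′ (λ _ → refl))

tight-∪ : CutCondition r c C → Tight r c C A B → Tight r c C A′ B′ → Tight r c C (A ∪ A′) (B ∪ B′)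
tight-∪ {r = r} {c} {C} {A} {B} {A′} {B′} cut tight tight′ =
  +-cancelʳ-≤ out∩ out∪ (∑∈ (A ∪ A′) r) (begin
  out∪ + out∩
    ≡⟨ interchange (∑∈ (B ∪ B′) c) _ (∑∈ (B ∩ B′) c) _ ⟩
  (∑∈ (B ∪ B′) c + ∑∈ (B ∩ B′) c) + (cap∪ + cap∩)
    ≤⟨ +-mono-≤ (≤-reflexive (∑∈-∪-∩ B B′ c)) (across-submodular A A′ B B′ C) ⟩
  (∑∈ B c + ∑∈ B′ c) + (cap + cap′)
    ≡⟨ interchange (∑∈ B c) _ cap _ ⟩
  (∑∈ B c + cap) + (∑∈ B′ c + cap′)
    ≤⟨ +-mono-≤ tight tight′ ⟩
  ∑∈ A r + ∑∈ A′ r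
    ≡⟨ ∑∈-∪-∩ A A′ r ⟨
  ∑∈ (A ∪ A′) r + ∑∈ (A ∩ A′) r
    ≤⟨ +-monoʳ-≤ (∑∈ (A ∪ A′) r) (cut (A ∩ A′) (B ∩ B′)) ⟩
  ∑∈ (A ∪ A′) r + out∩ ∎)
  where
  open ≤-Reasoning
  cap = across A (∁ B) C
  cap′ = across A′ (∁ B′) C
  cap∪ = across (A ∪ A′) (∁ (B ∪ B′)) C
  cap∩ = across (A ∩ A′) (∁ (B ∩ B′)) C
  out∪ = ∑∈ (B ∪ B′) c + cap∪
  out∩ = ∑∈ (B ∩ B′) c + cap∩

-- Removing the unit at (u, v) loses one unit on each side of every cut, except for cuts
-- separating u from v, which lose one unit on the supply side only.
cancel-units : ∀ a b {x y z} →
  x + indicator a ≤ (y + indicator b) + (z + indicator a * indicator (not b)) →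
  (a ≡ false → b ≡ true → ¬ (y + indicator b) + (z + indicator a * indicator (not b)) ≤ x + indicator a) →
  x ≤ y + z
cancel-units true true {x} {y} {z} ≤₁ _ =
  +-cancelʳ-≤ 1 x (y + z) (subst (x + 1 ≤_) (regroup y z) ≤₁)
  where regroup : ∀ y z → (y + 1) + (z + 0) ≡ (y + z) + 1
        regroup = solve-∀
cancel-units true false {x} {y} {z} ≤₁ _ =
  +-cancelʳ-≤ 1 x (y + z) (subst (x + 1 ≤_) (regroup y z) ≤₁)
  where regroup : ∀ y z → (y + 0) + (z + 1) ≡ (y + z) + 1
        regroup = solve-∀
cancel-units false false {x} {y} {z} ≤₀ _ = subst₂ _≤_ (+-identityʳ x) (regroup y z) ≤₀
  where regroup : ∀ y z → (y + 0) + (z + 0) ≡ y + z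
        regroup = solve-∀
cancel-units false true {x} {y} {z} _ not-tight =
  ≤-pred (subst₂ _<_ (+-identityʳ x) (regroup y z) (≰⇒> (not-tight refl refl)))
  where regroup : ∀ y z → (y + 1) + (z + 0) ≡ suc (y + z)
        regroup = solve-∀

module UnitShift {n} {r c r′ c′ : Fin n → ℕ} {C C′ : Matrix n} (u v : Fin n)
  (r≗ : ∀ w → r w ≡ r′ w + δ u w) (c≗ : ∀ w → c w ≡ c′ w + δ v w)
  (C≗ : ∀ a b → C a b ≡ C′ a b + δ u a * δ v b) where

  ∑∈-shift : ∀ (A : Pred n) {f f′ : Fin n → ℕ} x → (∀ w → f w ≡ f′ w + δ x w) →
    ∑∈ A f ≡ ∑∈ A f′ + indicator (A x)
  ∑∈-shift A {f} {f′} x f≗ = begin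
    ∑∈ A f                          ≡⟨ ∑∈-cong (λ _ → refl) f≗ ⟩
    ∑[ w ∈ A ] (f′ w + δ x w)       ≡⟨ ∑∈-distrib-+ A f′ (δ x) ⟩
    ∑∈ A f′ + ∑∈ A (δ x)            ≡⟨ cong (∑∈ A f′ +_) (∑∈-δ A x) ⟩
    ∑∈ A f′ + indicator (A x)       ∎
    where open ≡-Reasoning

  across-shift : ∀ A B → across A B C ≡ across A B C′ + indicator (A u) * indicator (B v)
  across-shift A B = begin
    across A B C
      ≡⟨ across-cong′ ⟩
    across A B (λ a b → C′ a b + δ u a * δ v b)
      ≡⟨ across-distrib-+ A B C′ _ ⟩
    across A B C′ + across A B (λ a b → δ u a * δ v b)
      ≡⟨ cong (across A B C′ +_) (across-⊗ A B (δ u) (δ v)) ⟩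
    across A B C′ + ∑∈ A (δ u) * ∑∈ B (δ v)
      ≡⟨ cong (across A B C′ +_) (cong₂ _*_ (∑∈-δ A u) (∑∈-δ B v)) ⟩
    across A B C′ + indicator (A u) * indicator (B v) ∎
    where
    open ≡-Reasoning
    across-cong′ = ∑∈-cong (λ _ → refl) (λ a → ∑∈-cong (λ _ → refl) (C≗ a))

  cut-shift : CutCondition r c C → (∀ A B → A u ≡ false → B v ≡ true → ¬ Tight r c C A B) →
    CutCondition r′ c′ C′
  cut-shift cut not-tight A B = cancel-units (A u) (B v) {∑∈ A r′} {∑∈ B c′} {across A (∁ B) C′}
    (subst₂ _≤_ (∑∈-shift A u r≗) (cong₂ _+_ (∑∈-shift B v c≗) (across-shift A (∁ B))) (cut A B))
    (λ Au≡false Bv≡true shifted-tight → not-tight A B Au≡false Bv≡true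
      (subst₂ _≤_ (sym (cong₂ _+_ (∑∈-shift B v c≗) (across-shift A (∁ B)))) (sym (∑∈-shift A u r≗))
        shifted-tight))

  flow-shift : IsFlow r′ c′ C′ X → IsFlow r c C (λ a b → X a b + δ u a * δ v b)
  flow-shift {X} flow = record
    { within-capacity = λ a b → subst (X a b + δ u a * δ v b ≤_) (sym (C≗ a b))
                                  (+-monoˡ-≤ _ (within-capacity flow a b))
    ; meets-supply = λ a → begin-equality
        sum (λ b → X a b + δ u a * δ v b)
          ≡⟨ ∑-distrib-+ (X a) (λ b → δ u a * δ v b) ⟩
        sum (X a) + sum (λ b → δ u a * δ v b)
          ≡⟨ cong (sum (X a) +_) (*-distribˡ-sum (δ u a) (δ v)) ⟨
        sum (X a) + δ u a * sum (δ v)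
          ≡⟨ cong₂ (λ x y → x + δ u a * y) (meets-supply flow a) (∑∈-δ (λ _ → true) v) ⟩
        r′ a + δ u a * 1
          ≡⟨ cong (r′ a +_) (*-identityʳ (δ u a)) ⟩
        r′ a + δ u a
          ≡⟨ r≗ a ⟨
        r a ∎
    ; within-demand = λ b → begin
        colSum (λ a b → X a b + δ u a * δ v b) b
          ≡⟨ ∑-distrib-+ (λ a → X a b) (λ a → δ u a * δ v b) ⟩
        colSum X b + ∑[ a < n ] (δ u a * δ v b)
          ≡⟨ cong (colSum X b +_) (*-distribʳ-sum (δ v b) (δ u)) ⟨
        colSum X b + sum (δ u) * δ v b
          ≡⟨ cong (λ x → colSum X b + x * δ v b) (∑∈-δ (λ _ → true) u) ⟩
        colSum X b + 1 * δ v b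
          ≡⟨ cong (colSum X b +_) (*-identityˡ (δ v b)) ⟩
        colSum X b + δ v b
          ≤⟨ +-monoˡ-≤ (δ v b) (within-demand flow b) ⟩
        c′ b + δ v b
          ≡⟨ c≗ b ⟨
        c b ∎
    }
    where open ≤-Reasoning

module Augment {n} {r c : Fin n → ℕ} {C : Matrix n} (cut : CutCondition r c C) (u : Fin n) where

  Usable : Fin n → Set
  Usable v = 0 < C u v × 0 < c v

  Separated : Fin n → Set
  Separated v = ∃ λ (A : Subset n) → ∃ λ (B : Subset n) →
    lookup A u ≡ false × lookup B v ≡ true × Tight r c C (lookup A) (lookup B)

  separated? : ∀ v → Dec (Separated v)
  separated? v = anySubset? λ A → anySubset? λ B →
    (lookup A u ≟ᵇ false) ×-dec (lookup B v ≟ᵇ true) ×-dec (_ ≤? _)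

  not-separated⇒not-tight : ∀ {v} → ¬ Separated v →
    ∀ A B → A u ≡ false → B v ≡ true → ¬ Tight r c C A B
  not-separated⇒not-tight {v} not-separated A B Au≡false Bv≡true tight = not-separated
    ( tabulateᵛ A , tabulateᵛ B
    , trans (lookup∘tabulate A u) Au≡false , trans (lookup∘tabulate B v) Bv≡true
    , Tight-cong (sym ∘ lookup∘tabulate A) (sym ∘ lookup∘tabulate B) tight)

  cover : (∀ v → Usable v → Separated v) → ∀ (vs : List (Fin n)) →
    ∃ λ A → ∃ λ B → Tight r c C A B × A u ≡ false × All (λ v → Usable v → B v ≡ true) vs
  cover _ [] = ∅ , ∅ , ∅-tight , refl , []
    where
    ∅-tight : Tight r c C ∅ ∅
    ∅-tight = subst₂ _≤_ (sym (cong₂ _+_ (sum-replicate-zero n) (sum-replicate-zero n)))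
                         (sym (sum-replicate-zero n)) z≤n
  cover separated (w ∷ vs) with cover separated vs | (0 <? C u w) ×-dec (0 <? c w)
  ... | A , B , tight , Au≡false , covered | no unusable =
    A , B , tight , Au≡false , (λ usable → ⊥-elim (unusable usable)) ∷ covered
  ... | A , B , tight , Au≡false , covered | yes usable with separated w usable
  ...   | A′ , B′ , A′u≡false , B′w≡true , tight′ =
    A ∪ lookup A′ , B ∪ lookup B′ , tight-∪ cut tight tight′ ,
    cong₂ _∨_ Au≡false A′u≡false ,
    (λ _ → trans (cong (B w ∨_) B′w≡true) (∨-zeroʳ (B w))) ∷ All.map (λ Bv → cong (_∨ _) ∘ Bv) covered

  -- A tight pair leaving out u whose demand side contains every usable v can be enlarged by u on
  -- the supply side and by the zero-demand vertices on the demand side at no cost: the cut condition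
  -- then forces r u = 0.
  no-covering-pair : 0 < r u → ¬ (∃ λ A → ∃ λ B →
    Tight r c C A B × A u ≡ false × (∀ v → Usable v → B v ≡ true))
  no-covering-pair ru>0 (A , B , tight , Au≡false , covers) =
    <⇒≱ ru>0 (+-cancelˡ-≤ (∑∈ A r) (r u) 0 (begin
      ∑∈ A r + r u                                    ≡⟨ supply-with-u ⟨
      ∑∈ (A ∪ ⁅ u ⁆) r                                ≤⟨ cut (A ∪ ⁅ u ⁆) (B ∪ Z) ⟩
      ∑∈ (B ∪ Z) c + across (A ∪ ⁅ u ⁆) (∁ (B ∪ Z)) C ≤⟨ +-mono-≤ demand-bound capacity-bound ⟩
      ∑∈ B c + across A (∁ B) C                       ≤⟨ tight ⟩
      ∑∈ A r                                          ≡⟨ +-identityʳ _ ⟨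
      ∑∈ A r + 0                                      ∎))
    where
    open ≤-Reasoning
    Z : Pred n
    Z v = c v ≡ᵇ 0

    supply-with-u : ∑∈ (A ∪ ⁅ u ⁆) r ≡ ∑∈ A r + r u
    supply-with-u = trans (∑∈-∪ A ⁅ u ⁆ r disjoint) (cong (∑∈ A r +_) (∑∈-⁅⁆ u r))
      where
      disjoint : A ∩ ⁅ u ⁆ ≗ ∅
      disjoint w with u ≟ w
      ... | yes refl rewrite Au≡false = refl
      ... | no _ = ∧-zeroʳ (A w)

    demand-bound : ∑∈ (B ∪ Z) c ≤ ∑∈ B c
    demand-bound = ≤-trans (∑∈-∪-≤ B Z c)
      (≤-reflexive (trans (cong (∑∈ B c +_) (∑-zero zero-demand)) (+-identityʳ _)))
      where
      zero-demand : ∀ v → mask (Z v) (c v) ≡ 0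
      zero-demand v with c v
      ... | zero = refl
      ... | suc _ = refl

    capacity-bound : across (A ∪ ⁅ u ⁆) (∁ (B ∪ Z)) C ≤ across A (∁ B) C
    capacity-bound = begin
      across (A ∪ ⁅ u ⁆) (∁ (B ∪ Z)) C
        ≤⟨ ∑∈-∪-≤ A ⁅ u ⁆ (λ a → ∑∈ (∁ (B ∪ Z)) (C a)) ⟩
      across A (∁ (B ∪ Z)) C + across ⁅ u ⁆ (∁ (B ∪ Z)) C
        ≡⟨ cong (across A (∁ (B ∪ Z)) C +_) row-u-blocked ⟩
      across A (∁ (B ∪ Z)) C + 0
        ≤⟨ +-monoˡ-≤ 0 (∑∈-mono-≤ (λ a → ∑∈-mono-⊆ (∁∪⊆∁ˡ B Z) (C a))) ⟩
      across A (∁ B) C + 0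
        ≡⟨ +-identityʳ _ ⟩
      across A (∁ B) C ∎
      where
      blocked : ∀ v → mask (∁ (B ∪ Z) v) (C u v) ≡ 0
      blocked v with B v in Bv | c v in cv | C u v in Cuv
      ... | true  | _     | _     = refl
      ... | false | zero  | _     = refl
      ... | false | suc _ | zero  = refl
      ... | false | suc _ | suc _
        with () ← trans (sym Bv) (covers v (subst (0 <_) (sym Cuv) (s≤s z≤n) , subst (0 <_) (sym cv) (s≤s z≤n)))
      row-u-blocked : across ⁅ u ⁆ (∁ (B ∪ Z)) C ≡ 0
      row-u-blocked = trans (∑∈-⁅⁆ u (λ a → ∑∈ (∁ (B ∪ Z)) (C a))) (∑-zero blocked)

  admissible : 0 < r u → ∃ λ v → Usable v × ¬ Separated v
  admissible ru>0 with any? (λ v → ((0 <? C u v) ×-dec (0 <? c v)) ×-dec ¬? (separated? v))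
  ... | yes found = found
  ... | no none with cover all-separated (allFin n)
    where
    all-separated : ∀ v → Usable v → Separated v
    all-separated v usable = decidable-stable (separated? v) (λ not-separated → none (v , usable , not-separated))
  ...   | A , B , tight , Au≡false , covered =
    ⊥-elim (no-covering-pair ru>0 (A , B , tight , Au≡false , tabulate⁻ covered))

supply-demand-of-total : ∀ m → sum r ≡ m → CutCondition r c C → ∃ (IsFlow r c C)
supply-demand-of-total {n} {r = r} {c} zero ∑r≡0 _ = (λ _ _ → 0) , record
  { within-capacity = λ _ _ → z≤n
  ; meets-supply = λ u → trans (sum-replicate-zero n) (sym (n≤0⇒n≡0 (subst (r u ≤_) ∑r≡0 (term≤∑ r u))))
  ; within-demand = λ v → subst (_≤ c v) (sym (sum-replicate-zero n)) z≤n
  }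
supply-demand-of-total {n} {r} {c} {C} (suc m) ∑r≡1+m cut with ∑-pos r (subst (0 <_) (sym ∑r≡1+m) (s≤s z≤n))
... | u , ru>0 with Augment.admissible cut u ru>0
... | v , (Cuv>0 , cv>0) , not-separated =
  _ , flow-shift (proj₂ (supply-demand-of-total m ∑r′≡m
        (cut-shift cut (Augment.not-separated⇒not-tight cut u not-separated))))
  where
  r≗ : ∀ w → r w ≡ (r w ∸ δ u w) + δ u w
  r≗ w = sym (m∸n+n≡m (δ-≤ u ru>0 w))
  c≗ : ∀ w → c w ≡ (c w ∸ δ v w) + δ v w
  c≗ w = sym (m∸n+n≡m (δ-≤ v cv>0 w))
  C≗ : ∀ a b → C a b ≡ (C a b ∸ δ u a * δ v b) + δ u a * δ v b
  C≗ a b = sym (m∸n+n≡m (δ⊗δ-≤ u v Cuv>0 a b))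
  open UnitShift u v r≗ c≗ C≗
  ∑r′≡m : sum (λ w → r w ∸ δ u w) ≡ m
  ∑r′≡m = suc-injective (trans (+-comm 1 _) (trans (sym (∑∈-shift (λ _ → true) u r≗)) ∑r≡1+m))

supply-demand : CutCondition r c C → ∃ (IsFlow r c C)
supply-demand = supply-demand-of-total _ refl


-- König's theorem for regular matrices

Regular : ℕ → Matrix n → Set
Regular k N = (∀ u → sum (N u) ≡ k) × (∀ v → colSum N v ≡ k)

-- In a square matrix these conditions force a permutation matrix.
IsPermutation : Matrix n → Set
IsPermutation X = (∀ u → sum (X u) ≡ 1) × (∀ v → colSum X v ≤ 1)

*-cancelˡ-≤-+ : ∀ k {a b x} → suc k * a ≤ suc k * b + x → a ≤ b + x
*-cancelˡ-≤-+ k {a} {b} {x} ka≤kb+x with ≤-total a b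
... | inj₁ a≤b = ≤-trans a≤b (m≤m+n b x)
... | inj₂ b≤a =
  subst (_≤ b + x) (m+[n∸m]≡n b≤a) (+-monoʳ-≤ b (≤-trans (m≤n*m (a ∸ b) (suc k)) k[a∸b]≤x))
  where
  k[a∸b]≤x : suc k * (a ∸ b) ≤ x
  k[a∸b]≤x = +-cancelˡ-≤ (suc k * b) _ x (subst (_≤ suc k * b + x)
    (trans (cong (suc k *_) (sym (m+[n∸m]≡n b≤a))) (*-distribˡ-+ (suc k) b (a ∸ b))) ka≤kb+x)

-- Counting the entries of the rows in A: k |A| is at most what the columns in B absorb plus what
-- leaves towards the columns outside B.
regular⇒cut : ∀ k (N : Matrix n) → Regular (suc k) N → CutCondition (λ _ → 1) (λ _ → 1) N
regular⇒cut {n} k N (rows , cols) A B =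
  *-cancelˡ-≤-+ k {∑∈ A (λ _ → 1)} {∑∈ B (λ _ → 1)} {across A (∁ B) N} (begin
  suc k * ∑[ u ∈ A ] 1
    ≡⟨ ∑∈-const A (suc k) ⟨
  ∑[ u ∈ A ] suc k
    ≡⟨ ∑∈-cong (λ _ → refl) (λ u → trans (sym (rows u)) (sym (∑∈-∁ B (N u)))) ⟩
  ∑[ u ∈ A ] (∑∈ B (N u) + ∑∈ (∁ B) (N u))
    ≡⟨ ∑∈-distrib-+ A (λ u → ∑∈ B (N u)) (λ u → ∑∈ (∁ B) (N u)) ⟩
  ∑[ u ∈ A ] ∑∈ B (N u) + across A (∁ B) N
    ≤⟨ +-monoˡ-≤ _ (∑∈≤∑ A (λ u → ∑∈ B (N u))) ⟩
  ∑[ u < n ] ∑∈ B (N u) + across A (∁ B) N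
    ≡⟨ cong (_+ across A (∁ B) N) (∑-comm (λ u v → mask (B v) (N u v))) ⟩
  ∑[ v < n ] ∑[ u < n ] mask (B v) (N u v) + across A (∁ B) N
    ≡⟨ cong (_+ across A (∁ B) N) (sum-cong-≗ (λ v → sym (mask-∑ (B v) (λ u → N u v)))) ⟩
  ∑∈ B (colSum N) + across A (∁ B) N
    ≡⟨ cong (_+ across A (∁ B) N) (trans (∑∈-cong (λ _ → refl) cols) (∑∈-const B (suc k))) ⟩
  suc k * ∑[ v ∈ B ] 1 + across A (∁ B) N ∎)
  where open ≤-Reasoning

-- Peel off one permutation matrix at a time, each found by Gale's theorem.
regular-decomposition : ∀ k (N : Matrix n) → Regular k N →
  ∃ λ (Xs : Fin k → Matrix n) → (∀ i → IsPermutation (Xs i)) × (∀ u v → ∑[ i < k ] Xs i u v ≤ N u v)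
regular-decomposition zero N _ = (λ ()) , (λ ()) , (λ _ _ → z≤n)
regular-decomposition {n} (suc k) N (rows , cols) = Xs , permutations , bound
  where
  first : ∃ (IsFlow (λ _ → 1) (λ _ → 1) N)
  first = supply-demand (regular⇒cut k N (rows , cols))
  P = proj₁ first
  flow = proj₂ first

  -- all n units of supply arrive, and no column receives more than one
  cols≡1 : ∀ v → colSum P v ≡ 1
  cols≡1 = ∑-tight (within-demand flow)
    (≤-reflexive (sym (trans (sym (∑-comm P)) (sum-cong-≗ (meets-supply flow)))))

  N′ : Matrix n
  N′ u v = N u v ∸ P u v

  regular′ : Regular k N′
  regular′ = (λ u → +-cancelʳ-≡ 1 _ _ (begin-equality
      sum (N′ u) + 1         ≡⟨ cong (sum (N′ u) +_) (meets-supply flow u) ⟨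
      sum (N′ u) + sum (P u) ≡⟨ ∑-∸ (λ v → within-capacity flow u v) ⟩
      sum (N u)              ≡⟨ trans (rows u) (+-comm 1 k) ⟩
      k + 1                  ∎))
    , (λ v → +-cancelʳ-≡ 1 _ _ (begin-equality
      colSum N′ v + 1           ≡⟨ cong (colSum N′ v +_) (cols≡1 v) ⟨
      colSum N′ v + colSum P v  ≡⟨ ∑-∸ (λ u → within-capacity flow u v) ⟩
      colSum N v                ≡⟨ trans (cols v) (+-comm 1 k) ⟩
      k + 1                     ∎))
    where open ≤-Reasoning

  rest = regular-decomposition k N′ regular′

  Xs : Fin (suc k) → Matrix n
  Xs zero = P
  Xs (suc i) = proj₁ rest i

  permutations : ∀ i → IsPermutation (Xs i)
  permutations zero = meets-supply flow , within-demand flow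
  permutations (suc i) = proj₁ (proj₂ rest) i

  bound : ∀ u v → ∑[ i < suc k ] Xs i u v ≤ N u v
  bound u v = begin
    P u v + ∑[ i < k ] proj₁ rest i u v ≤⟨ +-monoʳ-≤ (P u v) (proj₂ (proj₂ rest) u v) ⟩
    P u v + N′ u v                      ≡⟨ +-comm (P u v) (N′ u v) ⟩
    N′ u v + P u v                      ≡⟨ m∸n+n≡m (within-capacity flow u v) ⟩
    N u v                               ∎
    where open ≤-Reasoning

pad : ℕ → Matrix n → Matrix n
pad k F u v = F u v + F v u + mask (⁅ u ⁆ v) (k ∸ (sum (F u) + colSum F u))

pad-regular : ∀ k (F : Matrix n) → (∀ u → sum (F u) + colSum F u ≤ k) → Regular k (pad k F)
pad-regular {n} k F degree≤k = rows , cols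
  where
  slack : Fin n → ℕ
  slack u = k ∸ (sum (F u) + colSum F u)
  rows : ∀ u → sum (pad k F u) ≡ k
  rows u = begin
    sum (pad k F u)
      ≡⟨ ∑-distrib-+ (λ v → F u v + F v u) (λ v → mask (⁅ u ⁆ v) (slack u)) ⟩
    sum (λ v → F u v + F v u) + ∑∈ ⁅ u ⁆ (λ _ → slack u)
      ≡⟨ cong₂ _+_ (∑-distrib-+ (F u) (λ v → F v u)) (∑∈-⁅⁆ u (λ _ → slack u)) ⟩
    (sum (F u) + colSum F u) + slack u
      ≡⟨ m+[n∸m]≡n (degree≤k u) ⟩
    k ∎
    where open ≡-Reasoning
  cols : ∀ v → colSum (pad k F) v ≡ k
  cols v = begin
    colSum (pad k F) v
      ≡⟨ ∑-distrib-+ (λ u → F u v + F v u) (λ u → mask (⁅ u ⁆ v) (slack u)) ⟩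
    sum (λ u → F u v + F v u) + sum (λ u → mask (⁅ u ⁆ v) (slack u))
      ≡⟨ cong₂ _+_ (∑-distrib-+ (λ u → F u v) (F v))
                   (trans (sum-cong-≗ (λ u → cong (λ b → mask b (slack u)) (⁅⁆-sym u v))) (∑∈-⁅⁆ v slack)) ⟩
    (colSum F v + sum (F v)) + slack v
      ≡⟨ cong (_+ slack v) (+-comm (colSum F v) (sum (F v))) ⟩
    (sum (F v) + colSum F v) + slack v
      ≡⟨ m+[n∸m]≡n (degree≤k v) ⟩
    k ∎
    where open ≡-Reasoning

module Partners {n k} (Xs : Fin k → Matrix n) (permutation : ∀ i → IsPermutation (Xs i)) where

  private
    row-pos : ∀ i u → ∃ λ v → 0 < Xs i u v
    row-pos i u = ∑-pos (Xs i u) (subst (0 <_) (sym (proj₁ (permutation i) u)) (s≤s z≤n))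

  partner : Fin k → Fin n → Fin n
  partner i u = proj₁ (row-pos i u)

  partner-pos : ∀ i u → 0 < Xs i u (partner i u)
  partner-pos i u = proj₂ (row-pos i u)

  partner-injective : ∀ i {u t} → partner i u ≡ partner i t → u ≡ t
  partner-injective i {u} {t} same =
    ∑≤1⇒unique-pos (λ w → Xs i w (partner i u)) (proj₂ (permutation i) (partner i u))
    (partner-pos i u) (subst (λ v → 0 < Xs i t v) (sym same) (partner-pos i t))

  partners-distinct : ∀ u v → ∑[ i < k ] Xs i u v ≤ 1 →
    ∀ {i j} → partner i u ≡ v → partner j u ≡ v → i ≡ j
  partners-distinct u v ∑≤1 {i} {j} refl pj≡v = ∑≤1⇒unique-pos (λ l → Xs l u v) ∑≤1
    (partner-pos i u) (subst (λ w → 0 < Xs j u w) pj≡v (partner-pos j u))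


-- Counting edges

mask-<ᵇ-split : ∀ m n → m ≢ n → ∀ x → mask (m <ᵇ n) x + mask (n <ᵇ m) x ≡ x
mask-<ᵇ-split zero zero 0≢0 x = ⊥-elim (0≢0 refl)
mask-<ᵇ-split zero (suc n) _ x = +-identityʳ x
mask-<ᵇ-split (suc m) zero _ x = refl
mask-<ᵇ-split (suc m) (suc n) m≢n x = mask-<ᵇ-split m n (m≢n ∘ cong suc) x

n<ᵇn : ∀ n → (n <ᵇ n) ≡ false
n<ᵇn zero = refl
n<ᵇn (suc n) = n<ᵇn n

module Counting {n} (G : Graph n) where

  adjacency : Matrix n
  adjacency u v = indicator (adj G u v)

  count : Pred n → ℕ
  count p = ∑[ u ∈ p ] 1

  arcs : Pred n → Pred n → ℕ
  arcs p q = across p q adjacency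

  count-cong : p ≗ q → count p ≡ count q
  count-cong p≗q = ∑∈-cong p≗q (λ _ → refl)

  arcs-comm : ∀ (p q : Pred n) → arcs p q ≡ arcs q p
  arcs-comm p q = begin
    arcs p q
      ≡⟨ sum-cong-≗ (λ u → mask-∑ (p u) (λ v → mask (q v) (adjacency u v))) ⟩
    ∑[ u < n ] ∑[ v < n ] mask (p u) (mask (q v) (adjacency u v))
      ≡⟨ ∑-comm (λ u v → mask (p u) (mask (q v) (adjacency u v))) ⟩
    ∑[ v < n ] ∑[ u < n ] mask (p u) (mask (q v) (adjacency u v))
      ≡⟨ sum-cong-≗ (λ v → sum-cong-≗ (λ u → swap u v)) ⟩
    ∑[ v < n ] ∑[ u < n ] mask (q v) (mask (p u) (adjacency v u))
      ≡⟨ sum-cong-≗ (λ v → mask-∑ (q v) (λ u → mask (p u) (adjacency v u))) ⟨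
    arcs q p ∎
    where
    open ≡-Reasoning
    swap : ∀ u v → mask (p u) (mask (q v) (adjacency u v)) ≡ mask (q v) (mask (p u) (adjacency v u))
    swap u v = trans (mask-comm (p u) (q v) _) (cong (λ b → mask (q v) (mask (p u) (indicator b))) (adj-sym G u v))

  arcs-∪ˡ : ∀ (p q t : Pred n) → p ∩ q ≗ ∅ → arcs (p ∪ q) t ≡ arcs p t + arcs q t
  arcs-∪ˡ p q t disjoint = ∑∈-∪ p q (λ u → ∑∈ t (adjacency u)) disjoint

  arcs-∪ʳ : ∀ (p q t : Pred n) → q ∩ t ≗ ∅ → arcs p (q ∪ t) ≡ arcs p q + arcs p t
  arcs-∪ʳ p q t disjoint = trans (∑∈-cong (λ _ → refl) (λ u → ∑∈-∪ q t (adjacency u) disjoint))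
                                 (∑∈-distrib-+ p (λ u → ∑∈ q (adjacency u)) (λ u → ∑∈ t (adjacency u)))

  arcs-∪ : ∀ (p q : Pred n) → p ∩ q ≗ ∅ →
    arcs (p ∪ q) (p ∪ q) ≡ arcs p p + 2 * arcs p q + arcs q q
  arcs-∪ p q disjoint = begin
    arcs (p ∪ q) (p ∪ q)
      ≡⟨ arcs-∪ˡ p q (p ∪ q) disjoint ⟩
    arcs p (p ∪ q) + arcs q (p ∪ q)
      ≡⟨ cong₂ _+_ (arcs-∪ʳ p p q disjoint) (arcs-∪ʳ q p q disjoint) ⟩
    (arcs p p + arcs p q) + (arcs q p + arcs q q)
      ≡⟨ cong (λ x → (arcs p p + arcs p q) + (x + arcs q q)) (arcs-comm q p) ⟩
    (arcs p p + arcs p q) + (arcs p q + arcs q q)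
      ≡⟨ regroup (arcs p p) (arcs p q) (arcs q q) ⟩
    arcs p p + 2 * arcs p q + arcs q q ∎
    where
    open ≡-Reasoning
    regroup : ∀ a b c → (a + b) + (b + c) ≡ a + 2 * b + c
    regroup = solve-∀

  arcs-mono : p ⊆ p′ → q ⊆ q′ → arcs p q ≤ arcs p′ q′
  arcs-mono {q′ = q′} p⊆p′ q⊆q′ = ≤-trans (∑∈-mono-≤ (λ u → ∑∈-mono-⊆ q⊆q′ (adjacency u)))
                                          (∑∈-mono-⊆ p⊆p′ (λ u → ∑∈ q′ (adjacency u)))

  arcs-⁅⁆ : ∀ v q → arcs ⁅ v ⁆ q ≡ ∑[ w ∈ q ] adjacency v w
  arcs-⁅⁆ v q = ∑∈-⁅⁆ v (λ u → ∑∈ q (adjacency u))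

  arcs-loop : ∀ v → arcs ⁅ v ⁆ ⁅ v ⁆ ≡ 0
  arcs-loop v = trans (arcs-⁅⁆ v ⁅ v ⁆) (trans (∑∈-⁅⁆ v (adjacency v)) (cong indicator (irrefl G v)))

  degIn≡arcs : ∀ X v → degIn G X v ≡ arcs ⁅ v ⁆ (lookup X)
  degIn≡arcs X v = trans (Σ-Fin≡sum (λ u → indicator (lookup X u ∧ adj G v u)))
    (trans (sum-cong-≗ (λ u → sym (mask-∧ (lookup X u) (adj G v u) 1))) (sym (arcs-⁅⁆ v (lookup X))))

  -- Each edge {i, j} of G[X] is counted once in edgesIn (as i < j) and twice in arcs.
  2*edgesIn≡arcs : ∀ X → 2 * edgesIn G X ≡ arcs (lookup X) (lookup X)
  2*edgesIn≡arcs X = begin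
    2 * edgesIn G X
      ≡⟨ cong (2 *_) edges≡ ⟩
    2 * E
      ≡⟨ cong (E +_) (+-identityʳ E) ⟩
    E + E
      ≡⟨ cong (E +_) (∑-comm (λ i j → mask (lt i j) (e i j))) ⟩
    E + ∑[ i < n ] ∑[ j < n ] mask (lt j i) (e j i)
      ≡⟨ cong (E +_) (sum-cong-≗ λ i → sum-cong-≗ λ j → cong (mask (lt j i)) (e-sym j i)) ⟩
    E + ∑[ i < n ] ∑[ j < n ] mask (lt j i) (e i j)
      ≡⟨ ∑-distrib-+ (λ i → ∑[ j < n ] mask (lt i j) (e i j)) _ ⟨
    ∑[ i < n ] (∑[ j < n ] mask (lt i j) (e i j) + ∑[ j < n ] mask (lt j i) (e i j))
      ≡⟨ sum-cong-≗ (λ i → ∑-distrib-+ (λ j → mask (lt i j) (e i j)) (λ j → mask (lt j i) (e i j))) ⟨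
    ∑[ i < n ] ∑[ j < n ] (mask (lt i j) (e i j) + mask (lt j i) (e i j))
      ≡⟨ sum-cong-≗ (λ i → sum-cong-≗ (split i)) ⟩
    ∑[ i < n ] ∑[ j < n ] e i j
      ≡⟨ sum-cong-≗ (λ i → mask-∑ (x i) (λ j → mask (x j) (adjacency i j))) ⟨
    arcs x x ∎
    where
    open ≡-Reasoning
    x = lookup X
    lt : Fin n → Fin n → Bool
    lt i j = toℕ i <ᵇ toℕ j
    e : Fin n → Fin n → ℕ
    e i j = mask (x i) (mask (x j) (adjacency i j))
    E = ∑[ i < n ] ∑[ j < n ] mask (lt i j) (e i j)
    term : Fin n → Fin n → ℕ
    term i j = indicator (lt i j ∧ (x i ∧ (x j ∧ adj G i j)))
    nest : ∀ i j → mask (lt i j) (e i j) ≡ term i j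
    nest i j = begin
      mask (lt i j) (mask (x i) (mask (x j) (indicator (adj G i j))))
        ≡⟨ cong (mask (lt i j) ∘ mask (x i)) (mask-∧ (x j) _ 1) ⟩
      mask (lt i j) (mask (x i) (indicator (x j ∧ adj G i j)))
        ≡⟨ cong (mask (lt i j)) (mask-∧ (x i) _ 1) ⟩
      mask (lt i j) (indicator (x i ∧ (x j ∧ adj G i j)))
        ≡⟨ mask-∧ (lt i j) _ 1 ⟩
      indicator (lt i j ∧ (x i ∧ (x j ∧ adj G i j))) ∎
    edges≡ : edgesIn G X ≡ E
    edges≡ = trans (Σ-Fin≡sum (λ i → Σ-Fin (term i))) (sum-cong-≗ λ i →
      trans (Σ-Fin≡sum (term i)) (sum-cong-≗ λ j → sym (nest i j)))
    e-sym : ∀ i j → e i j ≡ e j i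
    e-sym i j = trans (mask-comm (x i) (x j) _) (cong (λ b → mask (x j) (mask (x i) (indicator b))) (adj-sym G i j))
    split : ∀ i j → mask (lt i j) (e i j) + mask (lt j i) (e i j) ≡ e i j
    split i j with i ≟ j
    ... | yes refl rewrite n<ᵇn (toℕ i) | irrefl G i = sym (trans (cong (mask (x i)) (mask-0 (x i))) (mask-0 (x i)))
    ... | no i≢j = mask-<ᵇ-split (toℕ i) (toℕ j) (i≢j ∘ toℕ-injective) (e i j)


-- φ_k and k-optimal sets

ℤ-sub-≤⇒ : ∀ a b c d → ℤ.+ a ℤ.- ℤ.+ b ℤ.≤ ℤ.+ c ℤ.- ℤ.+ d → a + d ≤ c + b
ℤ-sub-≤⇒ a b c d ≤₁ = ℤ.drop‿+≤+
  (subst₂ ℤ._≤_ (regroup (ℤ.+ a) (ℤ.+ b) (ℤ.+ d)) (regroup′ (ℤ.+ c) (ℤ.+ d) (ℤ.+ b))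
  (ℤ.+-monoˡ-≤ (ℤ.+ b ℤ.+ ℤ.+ d) ≤₁))
  where
  regroup : ∀ x y z → (x ℤ.- y) ℤ.+ (y ℤ.+ z) ≡ x ℤ.+ z
  regroup = ℤ-solve-∀
  regroup′ : ∀ x y z → (x ℤ.- y) ℤ.+ (z ℤ.+ y) ≡ x ℤ.+ z
  regroup′ = ℤ-solve-∀

ℤ-sub-≤⇐ : ∀ a b c d → a + d ≤ c + b → ℤ.+ a ℤ.- ℤ.+ b ℤ.≤ ℤ.+ c ℤ.- ℤ.+ d
ℤ-sub-≤⇐ a b c d ≤₁ =
  subst₂ ℤ._≤_ (regroup (ℤ.+ a) (ℤ.+ b) (ℤ.+ d)) (regroup′ (ℤ.+ c) (ℤ.+ d) (ℤ.+ b))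
  (ℤ.+-monoˡ-≤ (ℤ.- (ℤ.+ b ℤ.+ ℤ.+ d)) (ℤ.+≤+ ≤₁))
  where
  regroup : ∀ x y z → (x ℤ.+ z) ℤ.- (y ℤ.+ z) ≡ x ℤ.- y
  regroup = ℤ-solve-∀
  regroup′ : ∀ x y z → (x ℤ.+ z) ℤ.- (z ℤ.+ y) ≡ x ℤ.- y
  regroup′ = ℤ-solve-∀

≰-pred⇒≤ : ∀ {k d} → ¬ d ≤ k ∸ 1 → k ≤ d
≰-pred⇒≤ {zero} _ = z≤n
≰-pred⇒≤ {suc k} d≰k = ≰⇒> d≰k

module Potential {n} (G : Graph n) (k : ℕ) where
  open Counting G

  -- φ_k p ≤ φ_k q, doubled (so that edges become arcs) and with both sides moved so that no
  -- subtraction occurs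
  _≤φ_ : Pred n → Pred n → Set
  p ≤φ q = 2 * (k * count p) + arcs q q ≤ 2 * (k * count q) + arcs p p

  private
    doubled : ∀ X Y → lookup X ≗ p → lookup Y ≗ q →
      2 * (k * ∣ X ∣ + edgesIn G Y) ≡ 2 * (k * count p) + arcs q q
    doubled {p = p} {q = q} X Y X≗p Y≗q = begin
      2 * (k * ∣ X ∣ + edgesIn G Y)
        ≡⟨ *-distribˡ-+ 2 (k * ∣ X ∣) (edgesIn G Y) ⟩
      2 * (k * ∣ X ∣) + 2 * edgesIn G Y
        ≡⟨ cong₂ (λ c a → 2 * (k * c) + a) (trans (∣∣≡∑∈ X) (count-cong X≗p))
                                           (trans (2*edgesIn≡arcs Y) (across-cong Y≗q Y≗q)) ⟩
      2 * (k * count p) + arcs q q ∎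
      where open ≡-Reasoning

  φ-≤ : ∀ X Y → lookup X ≗ p → lookup Y ≗ q → p ≤φ q → φ G k X ℤ.≤ φ G k Y
  φ-≤ X Y X≗p Y≗q p≤φq = ℤ-sub-≤⇐ (k * ∣ X ∣) (edgesIn G X) (k * ∣ Y ∣) (edgesIn G Y)
    (*-cancelˡ-≤ 2 (subst₂ _≤_ (sym (doubled X Y X≗p Y≗q)) (sym (doubled Y X Y≗q X≗p)) p≤φq))

  φ-≤⁻ : ∀ X Y → lookup X ≗ p → lookup Y ≗ q → φ G k X ℤ.≤ φ G k Y → p ≤φ q
  φ-≤⁻ X Y X≗p Y≗q φX≤φY = subst₂ _≤_ (doubled X Y X≗p Y≗q) (doubled Y X Y≗q X≗p)
    (*-monoʳ-≤ 2 (ℤ-sub-≤⇒ (k * ∣ X ∣) (edgesIn G X) (k * ∣ Y ∣) (edgesIn G Y) φX≤φY))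

  private
    split-off : ∀ (p : Pred n) v → p v ≡ true → p ≗ (p ∩ ∁ ⁅ v ⁆) ∪ ⁅ v ⁆
    split-off p v pv w with v ≟ w
    ... | yes refl rewrite pv = refl
    ... | no _ = sym (trans (∨-identityʳ _) (∧-identityʳ (p w)))

    split-off-disjoint : ∀ (p : Pred n) v → (p ∩ ∁ ⁅ v ⁆) ∩ ⁅ v ⁆ ≗ ∅
    split-off-disjoint p v w with v ≟ w
    ... | yes _ = trans (∧-identityʳ _) (∧-zeroʳ (p w))
    ... | no _ = ∧-zeroʳ (p w ∧ true)

    count-split-off : ∀ (p : Pred n) v → p v ≡ true → count p ≡ count (p ∩ ∁ ⁅ v ⁆) + 1
    count-split-off p v pv = trans (count-cong (split-off p v pv))
      (trans (∑∈-∪ (p ∩ ∁ ⁅ v ⁆) ⁅ v ⁆ _ (split-off-disjoint p v))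
             (cong (count (p ∩ ∁ ⁅ v ⁆) +_) (∑∈-⁅⁆ v (λ _ → 1))))

  remove-vertex : ∀ (p : Pred n) v → p v ≡ true → k ≤ arcs ⁅ v ⁆ p → p ≤φ (p ∩ ∁ ⁅ v ⁆)
  remove-vertex p v pv k≤deg = begin
    2 * (k * count p) + arcs p∖v p∖v
      ≡⟨ cong (λ c → 2 * (k * c) + arcs p∖v p∖v) (count-split-off p v pv) ⟩
    2 * (k * (count p∖v + 1)) + arcs p∖v p∖v
      ≡⟨ regroupˡ k (count p∖v) (arcs p∖v p∖v) ⟩
    (2 * (k * count p∖v) + arcs p∖v p∖v) + 2 * k
      ≤⟨ +-monoʳ-≤ (2 * (k * count p∖v) + arcs p∖v p∖v) (*-monoʳ-≤ 2 (subst (k ≤_) deg≡ k≤deg)) ⟩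
    (2 * (k * count p∖v) + arcs p∖v p∖v) + 2 * d
      ≡⟨ regroupʳ (2 * (k * count p∖v)) (arcs p∖v p∖v) d ⟩
    2 * (k * count p∖v) + (arcs p∖v p∖v + 2 * d + 0)
      ≡⟨ cong (λ a → 2 * (k * count p∖v) + (arcs p∖v p∖v + 2 * d + a)) (arcs-loop v) ⟨
    2 * (k * count p∖v) + (arcs p∖v p∖v + 2 * d + arcs ⁅ v ⁆ ⁅ v ⁆)
      ≡⟨ cong (2 * (k * count p∖v) +_) arcs-p ⟨
    2 * (k * count p∖v) + arcs p p ∎
    where
    open ≤-Reasoning
    p∖v = p ∩ ∁ ⁅ v ⁆
    d = arcs p∖v ⁅ v ⁆
    p≗ = split-off p v pv
    disjoint = split-off-disjoint p v
    arcs-p : arcs p p ≡ arcs p∖v p∖v + 2 * d + arcs ⁅ v ⁆ ⁅ v ⁆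
    arcs-p = trans (across-cong p≗ p≗) (arcs-∪ p∖v ⁅ v ⁆ disjoint)
    deg≡ : arcs ⁅ v ⁆ p ≡ d
    deg≡ = begin-equality
      arcs ⁅ v ⁆ p                            ≡⟨ across-cong (λ _ → refl) p≗ ⟩
      arcs ⁅ v ⁆ (p∖v ∪ ⁅ v ⁆)                 ≡⟨ arcs-∪ʳ ⁅ v ⁆ p∖v ⁅ v ⁆ disjoint ⟩
      arcs ⁅ v ⁆ p∖v + arcs ⁅ v ⁆ ⁅ v ⁆        ≡⟨ cong (arcs ⁅ v ⁆ p∖v +_) (arcs-loop v) ⟩
      arcs ⁅ v ⁆ p∖v + 0                       ≡⟨ +-identityʳ _ ⟩
      arcs ⁅ v ⁆ p∖v                           ≡⟨ arcs-comm ⁅ v ⁆ p∖v ⟩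
      d                                       ∎
    regroupˡ : ∀ k c a → 2 * (k * (c + 1)) + a ≡ (2 * (k * c) + a) + 2 * k
    regroupˡ = solve-∀
    regroupʳ : ∀ x a d → (x + a) + 2 * d ≡ x + (a + 2 * d + 0)
    regroupʳ = solve-∀

  delete : Subset n → Fin n → Subset n
  delete X v = tabulateᵛ (lookup X ∩ ∁ ⁅ v ⁆)

  ∣delete∣ : ∀ X v → v ∈ X → ∣ X ∣ ≡ suc ∣ delete X v ∣
  ∣delete∣ X v v∈X = begin
    ∣ X ∣
      ≡⟨ ∣∣≡∑∈ X ⟩
    count (lookup X)
      ≡⟨ count-split-off (lookup X) v ([]=⇒lookup v∈X) ⟩
    count (lookup X ∩ ∁ ⁅ v ⁆) + 1
      ≡⟨ +-comm _ 1 ⟩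
    suc (count (lookup X ∩ ∁ ⁅ v ⁆))
      ≡⟨ cong suc (trans (∣∣≡∑∈ (delete X v)) (count-cong (lookup∘tabulate _))) ⟨
    suc ∣ delete X v ∣ ∎
    where open ≡-Reasoning

  φ-delete : ∀ X v → v ∈ X → k ≤ degIn G X v → φ G k X ℤ.≤ φ G k (delete X v)
  φ-delete X v v∈X k≤deg = φ-≤ X (delete X v) (λ _ → refl) (lookup∘tabulate _)
    (remove-vertex (lookup X) v ([]=⇒lookup v∈X) (subst (k ≤_) (degIn≡arcs X v) k≤deg))

  prune : ∀ m X → ∣ X ∣ ≡ m → ∃ λ D′ → IsKDependent G k D′ × φ G k X ℤ.≤ φ G k D′
  prune m X ∣X∣≡m with any? (λ v → (v ∈? X) ×-dec ¬? (degIn G X v ≤? k ∸ 1))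
  prune m X _ | no none = X , dependent , ℤ.≤-refl
    where
    dependent : IsKDependent G k X
    dependent v v∈X = decidable-stable (degIn G X v ≤? k ∸ 1) (λ high → none (v , v∈X , high))
  prune zero X ∣X∣≡0 | yes (v , v∈X , _) = ⊥-elim (0≢1+n (trans (sym ∣X∣≡0) (∣delete∣ X v v∈X)))
  prune (suc m) X ∣X∣≡1+m | yes (v , v∈X , high)
    with prune m (delete X v) (suc-injective (trans (sym (∣delete∣ X v v∈X)) ∣X∣≡1+m))
  ... | D′ , dependent , φX′≤φD′ =
    D′ , dependent , ℤ.≤-trans (φ-delete X v v∈X (≰-pred⇒≤ high)) φX′≤φD′

  optimal-dominates : ∀ {D} → IsKOptimal G k D → ∀ p → p ≤φ lookup D
  optimal-dominates {D} (_ , optimal) p with prune _ (tabulateᵛ p) refl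
  ... | D′ , dependent , φX≤φD′ =
    φ-≤⁻ (tabulateᵛ p) D (lookup∘tabulate p) (λ _ → refl) (ℤ.≤-trans φX≤φD′ (optimal D′ dependent))


-- The transport problem of a k-optimal set

cancel-doubled : ∀ k cP cT cY a a′ t → a′ ≤ a →
  2 * (k * (cP + cT)) + a ≤ 2 * (k * (cY + cP)) + (a′ + 2 * t + 0) → k * cT ≤ k * cY + t
cancel-doubled k cP cT cY a a′ t a′≤a ≤₁ = *-cancelˡ-≤ 2 (+-cancelʳ-≤ (2 * (k * cP) + a) _ _ (begin
  2 * (k * cT) + (2 * (k * cP) + a)
    ≡⟨ regroupˡ k cP cT a ⟩
  2 * (k * (cP + cT)) + a
    ≤⟨ ≤₁ ⟩
  2 * (k * (cY + cP)) + (a′ + 2 * t + 0)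
    ≤⟨ +-monoʳ-≤ (2 * (k * (cY + cP))) (+-monoˡ-≤ 0 (+-monoˡ-≤ (2 * t) a′≤a)) ⟩
  2 * (k * (cY + cP)) + (a + 2 * t + 0)
    ≡⟨ regroupʳ k cP cY a t ⟩
  2 * (k * cY + t) + (2 * (k * cP) + a) ∎))
  where
  open ≤-Reasoning
  regroupˡ : ∀ k cP cT a → 2 * (k * cT) + (2 * (k * cP) + a) ≡ 2 * (k * (cP + cT)) + a
  regroupˡ = solve-∀
  regroupʳ : ∀ k cP cY a t → 2 * (k * (cY + cP)) + (a + 2 * t + 0) ≡ 2 * (k * cY + t) + (2 * (k * cP) + a)
  regroupʳ = solve-∀

module OptimalTransport {n} (G : Graph n) (k : ℕ) (s d : Pred n)
  (independent : ∀ u v → s u ≡ true → s v ≡ true → adj G u v ≡ false)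
  (disjoint : s ∩ d ≗ ∅)
  (dominates : ∀ p → Potential._≤φ_ G k p d) where

  open Counting G

  supply demand : Fin n → ℕ
  supply u = mask (s u) k
  demand v = mask (d v) k

  capacity : Matrix n
  capacity u v = mask (s u) (mask (d v) (adjacency u v))

  no-arcs-in-s : ∀ (T : Pred n) → T ⊆ s → arcs T T ≡ 0
  no-arcs-in-s T T⊆s = ∑-zero λ u → mask-zero (T u) λ Tu → ∑-zero λ v → mask-zero (T v) λ Tv →
    cong indicator (independent u v (T⊆s u Tu) (T⊆s v Tv))

  cut : CutCondition supply demand capacity
  cut A B = subst₂ _≤_ (sym supplied) (sym (cong₂ _+_ demanded crossing))
    (cancel-doubled k (count P) (count T) (count Y) (arcs d d) (arcs P P) (arcs T P)
      (arcs-mono P⊆d P⊆d) (begin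
      2 * (k * (count P + count T)) + arcs d d      ≡⟨ cong (λ c → 2 * (k * c) + arcs d d) (sym count-P∪T) ⟩
      2 * (k * count (P ∪ T)) + arcs d d            ≤⟨ dominates (P ∪ T) ⟩
      2 * (k * count d) + arcs (P ∪ T) (P ∪ T)      ≡⟨ cong₂ (λ c a → 2 * (k * c) + a) count-d arcs-P∪T ⟩
      2 * (k * (count Y + count P)) + (arcs P P + 2 * arcs T P + 0) ∎))
    where
    open ≤-Reasoning
    T P Y : Pred n
    T = A ∩ s
    P = ∁ B ∩ d
    Y = B ∩ d
    P⊆d : P ⊆ d
    P⊆d v with B v
    ... | false = id
    ... | true = λ ()
    P∩T-empty : P ∩ T ≗ ∅
    P∩T-empty u with d u in du | s u in su
    ... | false | _ rewrite ∧-zeroʳ (not (B u)) = refl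
    ... | true | false rewrite ∧-zeroʳ (A u) = ∧-zeroʳ _
    ... | true | true with () ← trans (sym (cong₂ _∧_ su du)) (disjoint u)
    count-P∪T : count (P ∪ T) ≡ count P + count T
    count-P∪T = ∑∈-∪ P T _ P∩T-empty
    count-d : count d ≡ count Y + count P
    count-d = sym (∑∈-partition B d _)
    arcs-P∪T : arcs (P ∪ T) (P ∪ T) ≡ arcs P P + 2 * arcs T P + 0
    arcs-P∪T = trans (arcs-∪ P T P∩T-empty)
      (cong₂ (λ x y → arcs P P + 2 * x + y) (arcs-comm P T) (no-arcs-in-s T (λ u → ∧-conicalʳ (A u) (s u))))
    supplied : ∑∈ A supply ≡ k * count T
    supplied = trans (∑∈-∩ A s (λ _ → k)) (∑∈-const T k)
    demanded : ∑∈ B demand ≡ k * count Y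
    demanded = trans (∑∈-∩ B d (λ _ → k)) (∑∈-const Y k)
    crossing : across A (∁ B) capacity ≡ arcs T P
    crossing = across-mask A (∁ B) s d adjacency

module Matchings {n} (G : Graph n) (k : ℕ) (D S : Subset n)
  (optimal : IsKOptimal G k D) (independent : IsIndependent G S) (disjoint : Disjoint G S D) where

  s d : Pred n
  s = lookup S
  d = lookup D

  s∩d-empty : s ∩ d ≗ ∅
  s∩d-empty u with s u in su | d u in du
  ... | false | _ = refl
  ... | true | false = refl
  ... | true | true = ⊥-elim (disjoint u (lookup⇒[]= u S su) (lookup⇒[]= u D du))

  s⇒¬d : ∀ u → s u ≡ true → d u ≡ false
  s⇒¬d u su = subst (λ b → (b ∧ d u) ≡ false) su (s∩d-empty u)

  open OptimalTransport G k s d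
    (λ u v su sv → independent u v (lookup⇒[]= u S su) (lookup⇒[]= v S sv))
    s∩d-empty (Potential.optimal-dominates G k optimal) public

  module _ {F : Matrix n} (flow : IsFlow supply demand capacity F) where

    F-into-s : ∀ w u → s u ≡ true → F w u ≡ 0
    F-into-s w u su = n≤0⇒n≡0 (subst (F w u ≤_) capacity≡0 (within-capacity flow w u))
      where
      capacity≡0 : capacity w u ≡ 0
      capacity≡0 rewrite s⇒¬d u su = mask-0 (s w)

    s-degree : ∀ u → s u ≡ true → sum (F u) + colSum F u ≡ k
    s-degree u su = trans (cong₂ _+_ (trans (meets-supply flow u) (cong (λ b → mask b k) su))
                                     (∑-zero (λ w → F-into-s w u su)))
                          (+-identityʳ k)

    degree≤k : ∀ u → sum (F u) + colSum F u ≤ k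
    degree≤k u with s u in su
    ... | true = ≤-reflexive (s-degree u su)
    ... | false = subst (_≤ k) (cong (_+ colSum F u) (sym (trans (meets-supply flow u) (cong (λ b → mask b k) su))))
                        (≤-trans (within-demand flow u) (mask-≤ (d u) k))

    pad≤capacity : ∀ u → s u ≡ true → ∀ v → pad k F u v ≤ capacity u v
    pad≤capacity u su v = subst (_≤ capacity u v) (sym pad≡F) (within-capacity flow u v)
      where
      pad≡F : pad k F u v ≡ F u v
      pad≡F = begin
        F u v + F v u + mask (⁅ u ⁆ v) (k ∸ (sum (F u) + colSum F u))
          ≡⟨ cong₂ (λ x y → F u v + x + mask (⁅ u ⁆ v) (k ∸ y)) (F-into-s v u su) (s-degree u su) ⟩
        F u v + 0 + mask (⁅ u ⁆ v) (k ∸ k)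
          ≡⟨ cong (λ y → F u v + 0 + mask (⁅ u ⁆ v) y) (n∸n≡0 k) ⟩
        F u v + 0 + mask (⁅ u ⁆ v) 0
          ≡⟨ cong (F u v + 0 +_) (mask-0 (⁅ u ⁆ v)) ⟩
        F u v + 0 + 0
          ≡⟨ trans (+-identityʳ _) (+-identityʳ _) ⟩
        F u v ∎
        where open ≡-Reasoning

    module _ (Xs : Fin k → Matrix n) (permutation : ∀ i → IsPermutation (Xs i))
             (bound : ∀ u v → ∑[ i < k ] Xs i u v ≤ pad k F u v) where

      open Partners Xs permutation public

      multiplicity≤1 : ∀ u → s u ≡ true → ∀ v → ∑[ i < k ] Xs i u v ≤ 1
      multiplicity≤1 u su v = ≤-trans (bound u v) (≤-trans (pad≤capacity u su v)
        (≤-trans (mask-≤ (s u) _) (≤-trans (mask-≤ (d v) _) (indicator≤1 (adj G u v)))))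

      partner-edge : ∀ i u → s u ≡ true → (d (partner i u) ∧ adj G u (partner i u)) ≡ true
      partner-edge i u su = indicator-pos _ (begin-strict
        0                                    <⟨ partner-pos i u ⟩
        Xs i u v                             ≤⟨ term≤∑ (λ l → Xs l u v) i ⟩
        ∑[ l < k ] Xs l u v                  ≤⟨ bound u v ⟩
        pad k F u v                          ≤⟨ pad≤capacity u su v ⟩
        capacity u v                         ≡⟨ cong (λ b → mask b (mask (d v) (indicator (adj G u v)))) su ⟩
        mask (d v) (indicator (adj G u v))   ≡⟨ mask-∧ (d v) (adj G u v) 1 ⟩
        indicator (d v ∧ adj G u v)          ∎)
        where
        open ≤-Reasoning
        v = partner i u

      matching : ∀ i → IsSaturatingMatching G S D (partner i)
      matching i = (λ u u∈S → lookup⇒[]= _ D (∧-conicalˡ _ _ (partner-edge i u ([]=⇒lookup u∈S))))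
                 , (λ u u∈S → ∧-conicalʳ _ _ (partner-edge i u ([]=⇒lookup u∈S)))
                 , (λ u t _ _ → partner-injective i)

      edge-disjoint : ∀ i j → i ≢ j → ∀ u t → u ∈ S → t ∈ S → ¬ SameEdge u (partner i u) t (partner j t)
      edge-disjoint i j i≢j u .u u∈S _ (inj₁ (refl , same)) =
        i≢j (partners-distinct u (partner j u) (multiplicity≤1 u ([]=⇒lookup u∈S) (partner j u)) same refl)
      edge-disjoint i j _ u t u∈S t∈S (inj₂ (u≡partner , _)) =
        disjoint u u∈S (lookup⇒[]= u D
          (trans (cong d u≡partner) (∧-conicalˡ _ _ (partner-edge j t ([]=⇒lookup t∈S)))))

  Solution : Set
  Solution = Σ (Fin k → Fin n → Fin n) (λ M →
    (∀ i → IsSaturatingMatching G S D (M i)) ×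
    (∀ i j → i ≢ j → ∀ u t → u ∈ S → t ∈ S → ¬ SameEdge u (M i u) t (M j t)))

  from-decomposition : ∀ {F} (flow : IsFlow supply demand capacity F) →
    (∃ λ Xs → (∀ i → IsPermutation (Xs i)) × (∀ u v → ∑[ i < k ] Xs i u v ≤ pad k F u v)) → Solution
  from-decomposition flow (Xs , permutations , bound) =
      partner flow Xs permutations bound
    , matching flow Xs permutations bound
    , edge-disjoint flow Xs permutations bound

  from-flow : ∃ (IsFlow supply demand capacity) → Solution
  from-flow (F , flow) =
    from-decomposition flow (regular-decomposition k (pad k F) (pad-regular k F (degree≤k flow)))

corollary1p5 : (n : ℕ) (G : Graph n) (k : ℕ) → NonZero k →
    (D : Subset n) → IsKOptimal G k D →
    (S : Subset n) → IsIndependent G S → Disjoint G S D →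
    Σ (Fin k → Fin n → Fin n) (λ M →
      (∀ i → IsSaturatingMatching G S D (M i)) ×
      (∀ i j → ¬ (i ≡ j) → ∀ s t → s ∈ S → t ∈ S →
        ¬ SameEdge s (M i s) t (M j t)))
corollary1p5 n G k _ D optimal S independent disjoint = from-flow (supply-demand cut)
  where open Matchings G k D S optimal independent disjoint
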